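{- Let $n\ge 2$ and let $R$ be a $p_2$-orientation of $P_n$. Remove any $k-1$ flat edges of $R$ from $P_n$, obtaining $k$ vertex-disjoint paths, and let $R_1,\dots,R_k$ be the restrictions of $R$ to these paths. Then each $R_i$ is a $p_2$-orientation of its path.
   Context: Parallel Diffusion on a finite simple graph $G$: a configuration assigns an integer stack size $|v|$ (possibly negative) to each vertex. In one step all vertices fire simultaneously: each vertex sends one chip to each neighbour with strictly smaller stack size. Starting from $C_0$, $C_{t+1}$ is obtained from $C_t$ by one step. A configuration $D$ is a $p_2$-configuration if there are $C_0$ and $N$ such that $C_{t+2}=C_t$ and $C_{t+1}\ne C_t$ for all $t\ge N$, and $D=C_t$ for some $t\ge N$. The path $P_n$ has vertices $v_1,\dots,v_n$ and edges $e_i=v_iv_{i+1}$. A path orientation assigns to each edge either "flat" or one of its two directions. A configuration induces the orientation in which each edge is directed from its endpoint with larger stack size to its endpoint with smaller stack size, and is flat if equal; a $p_2$-orientation of a path is a path orientation induced by some $p_2$-configuration on that path. -}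

module Defs where

open import Data.Bool using (Bool; true; false; if_then_else_)
open import Data.Nat as ℕ using (ℕ; zero; suc; _≤_)
open import Data.Fin using (Fin; toℕ)
open import Data.Integer using (ℤ; _<?_; _+_; -_; +_)
open import Data.List using (List; []; _∷_; map; allFin; foldr)
open import Data.Vec using (Vec; lookup; tabulate; toList)
open import Data.Product using (Σ; ∃; _×_; _,_)
open import Relation.Nullary using (¬_; does)
open import Relation.Binary.PropositionalEquality using (_≡_; refl; sym; cong₂)
open import Relation.Nullary using (yes; no)
open import Data.Bool using (_∨_)
open import Data.Bool.Properties using (∨-comm)
open import Data.Nat.Properties using (1+n≢n)
open import Relation.Nullary.Decidable using (dec-false)

record Graph (n : ℕ) : Set where
  field
    adj     : Fin n → Fin n → Bool
    symm    : ∀ u v → adj u v ≡ adj v u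
    irrefl  : ∀ v → adj v v ≡ false

Config : ℕ → Set
Config n = Vec ℤ n

-- Chips flowing into a vertex with stack b from a neighbour with stack a:
-- +1 if a > b (neighbour sends one chip), -1 if a < b (vertex sends one chip), else 0.
flow : ℤ → ℤ → ℤ
flow a b = if does (b <? a) then + 1 else (if does (a <? b) then - (+ 1) else + 0)

step : ∀ {n} → Graph n → Config n → Config n
step {n} G c = tabulate λ v →
  lookup c v + foldr _+_ (+ 0) (map (λ u → if Graph.adj G u v then flow (lookup c u) (lookup c v) else + 0) (allFin n))

iter : ∀ {n} → Graph n → Config n → ℕ → Config n
iter G c zero    = c
iter G c (suc t) = step G (iter G c t)

IsP2Config : ∀ {n} → Graph n → Config n → Set
IsP2Config {n} G D =
  Σ (Config n) λ C₀ → Σ ℕ λ N →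
    (∀ t → N ≤ t → iter G C₀ (suc (suc t)) ≡ iter G C₀ t × ¬ (iter G C₀ (suc t) ≡ iter G C₀ t))
    × Σ ℕ λ t → N ≤ t × D ≡ iter G C₀ t

pathAdj : ∀ {n} → Fin n → Fin n → Bool
pathAdj u v = does (suc (toℕ u) ℕ.≟ toℕ v) ∨ does (suc (toℕ v) ℕ.≟ toℕ u)


private
  noSelf : ∀ m → does (suc m ℕ.≟ m) ≡ false
  noSelf m = dec-false (suc m ℕ.≟ m) 1+n≢n

pathGraph : (n : ℕ) → Graph n
pathGraph n = record
  { adj    = pathAdj
  ; symm   = λ u v → ∨-comm (does (suc (toℕ u) ℕ.≟ toℕ v)) (does (suc (toℕ v) ℕ.≟ toℕ u))
  ; irrefl = λ v → cong₂ _∨_ (noSelf (toℕ v)) (noSelf (toℕ v))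
  }

-- Path orientations: one entry per edge e_i = v_i v_{i+1}, in order.
-- right : directed v_i → v_{i+1};  left : directed v_{i+1} → v_i.
data Dir : Set where
  flat right left : Dir

dirOf : ℤ → ℤ → Dir
dirOf a b = if does (b <? a) then right else (if does (a <? b) then left else flat)

orient : List ℤ → List Dir
orient (a ∷ b ∷ rest) = dirOf a b ∷ orient (b ∷ rest)
orient _              = []

IsP2Orientation : (n : ℕ) → List Dir → Set
IsP2Orientation n R = Σ (Config n) λ D → IsP2Config (pathGraph n) D × orient (toList D) ≡ R

-- Removing the edges marked 'true' splits the path into subpaths; returns the
-- orientations (edge lists) of the resulting subpaths, left to right.
-- A subpath with edge list p is a copy of P_(1 + length p).
splitAux : List Dir → List Bool → List Dir × List (List Dir)
splitAux (d ∷ ds) (true  ∷ bs) with splitAux ds bs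
... | (p , ps) = ([] , p ∷ ps)
splitAux (d ∷ ds) (false ∷ bs) with splitAux ds bs
... | (p , ps) = (d ∷ p , ps)
splitAux _ _ = ([] , [])

split : List Dir → List Bool → List (List Dir)
split R S with splitAux R S
... | (p , ps) = p ∷ ps

-- On a path, one step of Parallel Diffusion acts on the list of stacks, and across a flat
-- edge it acts on the two sides independently. On a period-2 orbit a flat edge stays flat
-- at the next step: by chip conservation the left side regains its total only if nothing
-- crosses the edge. So both sides have period dividing 2. Neither side is fixed, since a
-- fixed side would leave the first (or, after reversing the path, the last) stack of the
-- whole path unchanged, and propagating along the path this forces the orbit to be fixed.
module Submission where

open import Defs
open import Data.Nat using (ℕ; suc; _≤_)
open import Data.Bool using (Bool; true)
open import Data.List using (List; length)
open import Data.List.Relation.Unary.All using (All)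
open import Data.List.Relation.Binary.Pointwise using (Pointwise)
open import Relation.Binary.PropositionalEquality using (_≡_)

open import Data.Bool using (false; if_then_else_)
open import Data.Empty using (⊥-elim)
open import Data.Fin using (Fin) renaming (zero to fz; suc to fs)
open import Data.Integer using (ℤ; +_; -_; _+_; _<?_)
import Data.Integer.Properties as ℤ
open import Algebra.Properties.AbelianGroup ℤ.+-0-abelianGroup using (identityʳ-unique)
open import Algebra.Properties.CommutativeSemigroup ℤ.+-commutativeSemigroup using (xy∙z≈xz∙y)
open import Data.Integer.Tactic.RingSolver using (solve-∀)
open import Data.List using ([]; _∷_; _++_; _∷ʳ_; reverse; foldr; map; allFin)
import Data.List.Base as List using (tabulate)
import Data.List.Properties as List
open import Data.List.Relation.Unary.All using ([]; _∷_)
open import Data.List.Relation.Binary.Pointwise using ([]; _∷_)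
open import Data.Nat using (zero; _<_; z≤n)
open import Data.Nat.Induction using (<-wellFounded)
import Data.Nat.Properties as ℕ
open import Data.Product using (_×_; _,_; proj₁; proj₂; ∃; ∃₂)
open import Data.Vec using (Vec; []; _∷_; lookup; tabulate; toList; fromList)
import Data.Vec.Properties as Vec
open import Function using (_∘_)
open import Induction.WellFounded using (Acc; acc)
open import Relation.Nullary using (yes; no)
open import Relation.Binary.PropositionalEquality
  using (_≢_; refl; sym; trans; cong; cong₂; subst; module ≡-Reasoning)

flow-self : ∀ a → flow a a ≡ + 0
flow-self a with a <? a
... | yes a<a = ⊥-elim (ℤ.<-irrefl refl a<a)
... | no _    = refl

flow-antisym : ∀ a b → flow a b ≡ - flow b a
flow-antisym a b with b <? a | a <? b
... | yes b<a | yes a<b = ⊥-elim (ℤ.<-asym b<a a<b)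
... | yes _   | no _    = refl
... | no _    | yes _   = refl
... | no _    | no _    = refl

flow≡0⇒≡ : ∀ a b → flow a b ≡ + 0 → a ≡ b
flow≡0⇒≡ a b eq with b <? a | a <? b
flow≡0⇒≡ a b () | yes _ | _
flow≡0⇒≡ a b () | no _  | yes _
... | no b≮a | no a≮b = ℤ.≤-antisym (ℤ.≮⇒≥ b≮a) (ℤ.≮⇒≥ a≮b)

dirOf≡flat⇒≡ : ∀ a b → dirOf a b ≡ flat → a ≡ b
dirOf≡flat⇒≡ a b eq with b <? a | a <? b
dirOf≡flat⇒≡ a b () | yes _ | _
dirOf≡flat⇒≡ a b () | no _  | yes _
... | no b≮a | no a≮b = ℤ.≤-antisym (ℤ.≮⇒≥ b≮a) (ℤ.≮⇒≥ a≮b)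

sumℤ : List ℤ → ℤ
sumℤ = foldr _+_ (+ 0)

last : {X : Set} → X → List X → X
last x []       = x
last x (y ∷ ys) = last y ys

last-++ : {X : Set} (a : X) (A : List X) (b : X) (B : List X) → last a (A ++ b ∷ B) ≡ last b B
last-++ a []      b B = refl
last-++ a (x ∷ A) b B = last-++ x A b B

reverse-∷ : {X : Set} (a : X) (A : List X) → ∃ λ W → reverse (a ∷ A) ≡ last a A ∷ W × last (last a A) W ≡ a
reverse-∷ a []      = [] , refl , refl
reverse-∷ a (x ∷ A) with reverse-∷ x A
... | W , eq , _ = W ∷ʳ a , trans (List.unfold-reverse a (x ∷ A)) (cong (_∷ʳ a) eq) , last-++ (last x A) W a []

++-cancel-≡length : {X : Set} {xs ys us vs : List X} → length xs ≡ length us → xs ++ ys ≡ us ++ vs → xs ≡ us × ys ≡ vs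
++-cancel-≡length {xs = []}    {us = []}    _   eq = refl , eq
++-cancel-≡length {xs = x ∷ xs} {us = u ∷ us} len eq with List.∷-injective eq
... | refl , eq′ with ++-cancel-≡length {xs = xs} {us = us} (ℕ.suc-injective len) eq′
...   | refl , eq″ = refl , eq″

-- One step on the path whose stacks are listed left to right, with l and r extra chips
-- arriving from outside at its first and last vertex.
diffuse : ℤ → ℤ → List ℤ → List ℤ
diffuse l r []          = []
diffuse l r (x ∷ [])    = x + l + r ∷ []
diffuse l r (x ∷ y ∷ t) = x + l + flow y x ∷ diffuse (flow x y) r (y ∷ t)

diffuse₀ : List ℤ → List ℤ
diffuse₀ = diffuse (+ 0) (+ 0)

length-diffuse : ∀ l r xs → length (diffuse l r xs) ≡ length xs
length-diffuse l r []          = refl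
length-diffuse l r (x ∷ [])    = refl
length-diffuse l r (x ∷ y ∷ t) = cong suc (length-diffuse (flow x y) r (y ∷ t))

length-diffuse-after : ∀ l r {l′ r′ X Y} → diffuse l′ r′ X ≡ Y → length (diffuse l r Y) ≡ length X
length-diffuse-after l r {l′} {r′} {X} refl =
  trans (length-diffuse l r (diffuse l′ r′ X)) (length-diffuse l′ r′ X)

diffuse-∷ : ∀ l r x xs → ∃₂ λ y ys → diffuse l r (x ∷ xs) ≡ y ∷ ys
diffuse-∷ l r x []      = _ , _ , refl
diffuse-∷ l r x (_ ∷ _) = _ , _ , refl

diffuse-++ : ∀ l r a A y Y →
  diffuse l r ((a ∷ A) ++ y ∷ Y) ≡
  diffuse l (flow y (last a A)) (a ∷ A) ++ diffuse (flow (last a A) y) r (y ∷ Y)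
diffuse-++ l r a []      y Y = refl
diffuse-++ l r a (x ∷ A) y Y = cong (_ ∷_) (diffuse-++ (flow a x) r x A y Y)

diffuse-++-flat : ∀ l r a A b B → last a A ≡ b →
  diffuse l r ((a ∷ A) ++ b ∷ B) ≡ diffuse l (+ 0) (a ∷ A) ++ diffuse (+ 0) r (b ∷ B)
diffuse-++-flat l r a A b B refl rewrite diffuse-++ l r a A (last a A) B | flow-self (last a A) = refl

diffuse-reverse : ∀ l r xs → diffuse l r (reverse xs) ≡ reverse (diffuse r l xs)
diffuse-reverse l r []          = refl
diffuse-reverse l r (x ∷ [])    = cong (_∷ []) (xy∙z≈xz∙y x l r)
diffuse-reverse l r (x ∷ y ∷ t) with reverse-∷ y t | diffuse-reverse l (flow x y) (y ∷ t)
... | W , eq , lastW | ih = begin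
  diffuse l r (reverse (x ∷ y ∷ t))
    ≡⟨ cong (diffuse l r) (trans (List.unfold-reverse x (y ∷ t)) (cong (_∷ʳ x) eq)) ⟩
  diffuse l r ((w ∷ W) ++ x ∷ [])
    ≡⟨ diffuse-++ l r w W x [] ⟩
  diffuse l (flow x (last w W)) (w ∷ W) ∷ʳ (x + flow (last w W) x + r)
    ≡⟨ cong (λ z → diffuse l (flow x z) (w ∷ W) ∷ʳ (x + flow z x + r)) lastW ⟩
  diffuse l (flow x y) (w ∷ W) ∷ʳ (x + flow y x + r)
    ≡⟨ cong₂ _∷ʳ_ (trans (cong (diffuse l (flow x y)) (sym eq)) ih) (xy∙z≈xz∙y x (flow y x) r) ⟩
  reverse (diffuse (flow x y) l (y ∷ t)) ∷ʳ (x + r + flow y x)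
    ≡⟨ sym (List.unfold-reverse _ (diffuse (flow x y) l (y ∷ t))) ⟩
  reverse (diffuse r l (x ∷ y ∷ t))
    ∎
  where
  open ≡-Reasoning
  w : ℤ
  w = last y t

sum-diffuse : ∀ l r x xs → sumℤ (diffuse l r (x ∷ xs)) ≡ sumℤ (x ∷ xs) + (l + r)
sum-diffuse l r x []      = rearrange x l r
  where
  rearrange : ∀ x l r → x + l + r + + 0 ≡ x + + 0 + (l + r)
  rearrange = solve-∀
sum-diffuse l r x (y ∷ t) = begin
  x + l + flow y x + sumℤ (diffuse (flow x y) r (y ∷ t))
    ≡⟨ cong₂ (λ f s → x + l + f + s) (flow-antisym y x) (sum-diffuse (flow x y) r y t) ⟩
  x + l + - flow x y + (sumℤ (y ∷ t) + (flow x y + r))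
    ≡⟨ cancel x l (flow x y) (sumℤ (y ∷ t)) r ⟩
  x + sumℤ (y ∷ t) + (l + r)
    ∎
  where
  open ≡-Reasoning
  cancel : ∀ x l f s r → x + l + - f + (s + (f + r)) ≡ x + s + (l + r)
  cancel = solve-∀

x+0+f≡x⇒f≡0 : ∀ x f → x + + 0 + f ≡ x → f ≡ + 0
x+0+f≡x⇒f≡0 x f eq = identityʳ-unique x f (trans (cong (_+ f) (sym (ℤ.+-identityʳ x))) eq)

-- The inflows l, l′ are kept abstract because the recursive call receives flow y y, which is
-- only propositionally 0.
head-fixed⇒fixed : ∀ {l l′} x P Q → l ≡ + 0 → l′ ≡ + 0 →
  diffuse l (+ 0) (x ∷ P) ≡ x ∷ Q → diffuse l′ (+ 0) (x ∷ Q) ≡ x ∷ P → Q ≡ P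
head-fixed⇒fixed x []      Q _ _ there _ = sym (List.∷-injectiveʳ there)
head-fixed⇒fixed x (y ∷ P) [] _ _ there _ with diffuse-∷ (flow x y) (+ 0) y P
... | _ , _ , eq with () ← trans (sym eq) (List.∷-injectiveʳ there)
head-fixed⇒fixed x (y ∷ P) (z ∷ Q) refl refl there back
  with flow≡0⇒≡ y x (x+0+f≡x⇒f≡0 x _ (List.∷-injectiveˡ there))
     | flow≡0⇒≡ z x (x+0+f≡x⇒f≡0 x _ (List.∷-injectiveˡ back))
... | refl | refl =
  cong (y ∷_) (head-fixed⇒fixed y P Q (flow-self y) (flow-self y)
                                (List.∷-injectiveʳ there) (List.∷-injectiveʳ back))

TwoPeriodic : List ℤ → Set
TwoPeriodic X = diffuse₀ (diffuse₀ X) ≡ X × diffuse₀ X ≢ X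

twoPeriodic-moves-head : ∀ {x P} → TwoPeriodic (x ∷ P) → ∀ Q → diffuse₀ (x ∷ P) ≢ x ∷ Q
twoPeriodic-moves-head {x} {P} (back , moves) Q there =
  moves (trans there (cong (x ∷_) (head-fixed⇒fixed x P Q refl refl there back′)))
  where
  back′ : diffuse₀ (x ∷ Q) ≡ x ∷ P
  back′ = trans (cong diffuse₀ (sym there)) back

twoPeriodic-moves-last : ∀ {x P} → TwoPeriodic (x ∷ P) →
  ∀ y Q → diffuse₀ (x ∷ P) ≡ y ∷ Q → last y Q ≢ last x P
twoPeriodic-moves-last {x} {P} (back , moves) y Q there sameLast
  with reverse-∷ x P | reverse-∷ y Q
... | W , revX , _ | V , revY , _ = moves (trans there (List.reverse-injective revY≡revX))
  where
  revY′ : reverse (y ∷ Q) ≡ last x P ∷ V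
  revY′ = trans revY (cong (_∷ V) sameLast)
  there′ : diffuse₀ (last x P ∷ W) ≡ last x P ∷ V
  there′ = begin
    diffuse₀ (last x P ∷ W)    ≡⟨ cong diffuse₀ (sym revX) ⟩
    diffuse₀ (reverse (x ∷ P)) ≡⟨ diffuse-reverse (+ 0) (+ 0) (x ∷ P) ⟩
    reverse (diffuse₀ (x ∷ P)) ≡⟨ cong reverse there ⟩
    reverse (y ∷ Q)            ≡⟨ revY′ ⟩
    last x P ∷ V               ∎
    where open ≡-Reasoning
  back′ : diffuse₀ (last x P ∷ V) ≡ last x P ∷ W
  back′ = begin
    diffuse₀ (last x P ∷ V)               ≡⟨ cong diffuse₀ (sym revY′) ⟩
    diffuse₀ (reverse (y ∷ Q))            ≡⟨ diffuse-reverse (+ 0) (+ 0) (y ∷ Q) ⟩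
    reverse (diffuse₀ (y ∷ Q))            ≡⟨ cong (reverse ∘ diffuse₀) (sym there) ⟩
    reverse (diffuse₀ (diffuse₀ (x ∷ P))) ≡⟨ cong reverse back ⟩
    reverse (x ∷ P)                       ≡⟨ revX ⟩
    last x P ∷ W                          ∎
    where open ≡-Reasoning
  revY≡revX : reverse (y ∷ Q) ≡ reverse (x ∷ P)
  revY≡revX = begin
    reverse (y ∷ Q) ≡⟨ revY′ ⟩
    last x P ∷ V    ≡⟨ cong (last x P ∷_) (head-fixed⇒fixed (last x P) W V refl refl there′ back′) ⟩
    last x P ∷ W    ≡⟨ revX ⟨
    reverse (x ∷ P) ∎
    where open ≡-Reasoning

junction-stays-flat : ∀ a A a′ A′ b′ B′ Z → diffuse₀ (a ∷ A) ≡ a′ ∷ A′ →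
  diffuse₀ ((a′ ∷ A′) ++ b′ ∷ B′) ≡ (a ∷ A) ++ Z → last a′ A′ ≡ b′
junction-stays-flat a A a′ A′ b′ B′ Z there back = sym (flow≡0⇒≡ b′ (last a′ A′) noCrossing)
  where
  crossing : ℤ
  crossing = flow b′ (last a′ A′)
  firstBlock : diffuse (+ 0) crossing (a′ ∷ A′) ≡ a ∷ A
  firstBlock = proj₁ (++-cancel-≡length (length-diffuse-after _ _ there)
                                        (trans (sym (diffuse-++ _ _ a′ A′ b′ B′)) back))
  -- The first block exchanges chips with the rest only across the junction.
  conservation : sumℤ (a ∷ A) + crossing ≡ sumℤ (a ∷ A)
  conservation = begin
    sumℤ (a ∷ A) + crossing
      ≡⟨ cong (λ s → s + crossing) (sym (ℤ.+-identityʳ (sumℤ (a ∷ A)))) ⟩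
    sumℤ (a ∷ A) + (+ 0 + + 0) + crossing
      ≡⟨ cong (λ s → s + crossing) (sym (sum-diffuse _ _ a A)) ⟩
    sumℤ (diffuse₀ (a ∷ A)) + crossing
      ≡⟨ cong (λ X → sumℤ X + crossing) there ⟩
    sumℤ (a′ ∷ A′) + crossing
      ≡⟨ cong (λ f → sumℤ (a′ ∷ A′) + f) (sym (ℤ.+-identityˡ crossing)) ⟩
    sumℤ (a′ ∷ A′) + (+ 0 + crossing)
      ≡⟨ sym (sum-diffuse _ _ a′ A′) ⟩
    sumℤ (diffuse (+ 0) crossing (a′ ∷ A′))
      ≡⟨ cong sumℤ firstBlock ⟩
    sumℤ (a ∷ A)
      ∎
    where open ≡-Reasoning
  noCrossing : crossing ≡ + 0
  noCrossing = identityʳ-unique (sumℤ (a ∷ A)) crossing conservation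

twoPeriodic-cut : ∀ a A b B → last a A ≡ b → TwoPeriodic ((a ∷ A) ++ b ∷ B) →
  TwoPeriodic (a ∷ A) × TwoPeriodic (b ∷ B)
twoPeriodic-cut a A b B flat₀ periodic@(back , _)
  with diffuse-∷ (+ 0) (+ 0) a A | diffuse-∷ (+ 0) (+ 0) b B
... | a′ , A′ , thereA | b′ , B′ , thereB =
  (trans (cong diffuse₀ thereA) (proj₁ back′) , movesA) ,
  (trans (cong diffuse₀ thereB) (proj₂ back′) , movesB)
  where
  there : diffuse₀ ((a ∷ A) ++ b ∷ B) ≡ (a′ ∷ A′) ++ b′ ∷ B′
  there = trans (diffuse-++-flat _ _ a A b B flat₀) (cong₂ _++_ thereA thereB)
  back₁ : diffuse₀ ((a′ ∷ A′) ++ b′ ∷ B′) ≡ (a ∷ A) ++ b ∷ B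
  back₁ = trans (cong diffuse₀ (sym there)) back
  flat₁ : last a′ A′ ≡ b′
  flat₁ = junction-stays-flat a A a′ A′ b′ B′ (b ∷ B) thereA back₁
  back′ : diffuse₀ (a′ ∷ A′) ≡ a ∷ A × diffuse₀ (b′ ∷ B′) ≡ b ∷ B
  back′ = ++-cancel-≡length (length-diffuse-after _ _ thereA)
    (trans (sym (diffuse-++-flat _ _ a′ A′ b′ B′ flat₁)) back₁)
  movesA : diffuse₀ (a ∷ A) ≢ a ∷ A
  movesA fixed = twoPeriodic-moves-head periodic (A ++ diffuse₀ (b ∷ B))
    (trans (diffuse-++-flat _ _ a A b B flat₀) (cong (_++ diffuse₀ (b ∷ B)) fixed))
  movesB : diffuse₀ (b ∷ B) ≢ b ∷ B
  movesB fixed = twoPeriodic-moves-last periodic a′ (A′ ++ b ∷ B)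
    (trans (diffuse-++-flat _ _ a A b B flat₀) (cong₂ _++_ thereA fixed))
    (trans (last-++ a′ A′ b B) (sym (last-++ a A b B)))

Period2 : ∀ {m} → Graph m → Config m → Set
Period2 G D = step G (step G D) ≡ D × step G D ≢ D

p2Config⇒period2 : ∀ {m} (G : Graph m) {D} → IsP2Config G D → Period2 G D
p2Config⇒period2 G (_ , _ , periodic , t , N≤t , refl) = periodic t N≤t

period2⇒p2Config : ∀ {m} (G : Graph m) {D} → Period2 G D → IsP2Config G D
period2⇒p2Config G {D} (back , moves) = D , 0 , (λ t _ → back-iter t , moves-iter t) , 0 , z≤n , refl
  where
  back-iter : ∀ t → iter G D (suc (suc t)) ≡ iter G D t
  back-iter zero    = back
  back-iter (suc t) = cong (step G) (back-iter t)
  moves-iter : ∀ t → iter G D (suc t) ≢ iter G D t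
  moves-iter zero          = moves
  moves-iter (suc t) moved = moves-iter t (sym (trans (sym (back-iter t)) moved))

edgeInflow : ∀ {m} → Config m → Fin m → Fin m → ℤ
edgeInflow c v u = if pathAdj u v then flow (lookup c u) (lookup c v) else + 0

-- step (pathGraph m) c is definitionally tabulate (λ v → lookup c v + inflow c v).
inflow : ∀ {m} → Config m → Fin m → ℤ
inflow {m} c v = sumℤ (map (edgeInflow c v) (allFin m))

atFirst : ∀ {m} → ℤ → Fin m → ℤ
atFirst l fz     = l
atFirst l (fs _) = + 0

sumℤ-tabulate-0 : ∀ k → sumℤ (List.tabulate {n = k} (λ _ → + 0)) ≡ + 0
sumℤ-tabulate-0 zero    = refl
sumℤ-tabulate-0 (suc k) = cong (_+_ (+ 0)) (sumℤ-tabulate-0 k)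

inflow-suc : ∀ {k} x (c : Config k) v → inflow (x ∷ c) (fs v) ≡ edgeInflow (x ∷ c) (fs v) fz + inflow c v
inflow-suc x c v = cong (_+_ (edgeInflow (x ∷ c) (fs v) fz))
  (trans (cong sumℤ (List.map-tabulate fs (edgeInflow (x ∷ c) (fs v))))
         (sym (cong sumℤ (List.map-tabulate (λ u → u) (edgeInflow c v)))))

inflow-first : ∀ {k} x y (c : Config k) → inflow (x ∷ y ∷ c) fz ≡ flow y x
inflow-first {k} x y c = begin
  inflow (x ∷ y ∷ c) fz  ≡⟨ ℤ.+-identityˡ _ ⟩
  flow y x + sumℤ others ≡⟨ cong (_+_ (flow y x)) nonNeighbours ⟩
  flow y x + + 0         ≡⟨ ℤ.+-identityʳ _ ⟩
  flow y x               ∎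
  where
  open ≡-Reasoning
  others : List ℤ
  others = map (edgeInflow (x ∷ y ∷ c) fz) (List.tabulate (fs ∘ fs))
  nonNeighbours : sumℤ others ≡ + 0
  nonNeighbours = trans (cong sumℤ (List.map-tabulate (fs ∘ fs) (edgeInflow (x ∷ y ∷ c) fz))) (sumℤ-tabulate-0 k)

toList-stepWith : ∀ {m} l (c : Config m) →
  toList (tabulate (λ v → lookup c v + (atFirst l v + inflow c v))) ≡ diffuse l (+ 0) (toList c)
toList-stepWith l []          = refl
toList-stepWith l (x ∷ [])    = cong (_∷ []) (sym (ℤ.+-assoc x l (+ 0)))
toList-stepWith l (x ∷ y ∷ c) =
  cong₂ _∷_ first (trans (cong toList (Vec.tabulate-cong rest)) (toList-stepWith (flow x y) (y ∷ c)))
  where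
  first : x + (l + inflow (x ∷ y ∷ c) fz) ≡ x + l + flow y x
  first = trans (cong (λ i → x + (l + i)) (inflow-first x y c)) (sym (ℤ.+-assoc x l (flow y x)))
  edge : ∀ v → edgeInflow (x ∷ y ∷ c) (fs v) fz ≡ atFirst (flow x y) v
  edge fz     = refl
  edge (fs _) = refl
  rest : ∀ v → lookup (y ∷ c) v + (+ 0 + inflow (x ∷ y ∷ c) (fs v))
             ≡ lookup (y ∷ c) v + (atFirst (flow x y) v + inflow (y ∷ c) v)
  rest v = cong (λ i → lookup (y ∷ c) v + i)
    (trans (ℤ.+-identityˡ _) (trans (inflow-suc x (y ∷ c) v) (cong (λ e → e + inflow (y ∷ c) v) (edge v))))

toList-step : ∀ {m} (c : Config m) → toList (step (pathGraph m) c) ≡ diffuse₀ (toList c)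
toList-step c = trans (cong toList (Vec.tabulate-cong noExtra)) (toList-stepWith (+ 0) c)
  where
  noExtra : ∀ v → lookup c v + inflow c v ≡ lookup c v + (atFirst (+ 0) v + inflow c v)
  noExtra fz     = cong (λ i → lookup c fz + i) (sym (ℤ.+-identityˡ _))
  noExtra (fs v) = cong (λ i → lookup c (fs v) + i) (sym (ℤ.+-identityˡ _))

toList-injective : ∀ {m} {xs ys : Vec ℤ m} → toList xs ≡ toList ys → xs ≡ ys
toList-injective {xs = xs} {ys} eq = trans (sym (Vec.cast-is-id refl xs)) (Vec.toList-injective refl xs ys eq)

period2⇒twoPeriodic : ∀ {m} {D : Config m} → Period2 (pathGraph m) D → TwoPeriodic (toList D)
period2⇒twoPeriodic {D = D} (back , moves) =
  trans (cong diffuse₀ (sym (toList-step D))) (trans (sym (toList-step _)) (cong toList back)) ,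
  λ fixed → moves (toList-injective (trans (toList-step D) fixed))

twoPeriodic⇒period2 : ∀ {m} {D : Config m} → TwoPeriodic (toList D) → Period2 (pathGraph m) D
twoPeriodic⇒period2 {D = D} (back , moves) =
  toList-injective (trans (toList-step _) (trans (cong diffuse₀ (toList-step D)) back)) ,
  λ fixed → moves (trans (sym (toList-step D)) (cong toList fixed))

length-orient : ∀ x P → length (orient (x ∷ P)) ≡ length P
length-orient x []      = refl
length-orient x (y ∷ P) = cong suc (length-orient y P)

twoPeriodic⇒p2Orientation : ∀ X → TwoPeriodic X → IsP2Orientation (suc (length (orient X))) (orient X)
twoPeriodic⇒p2Orientation []      (_ , moves) = ⊥-elim (moves refl)
twoPeriodic⇒p2Orientation (x ∷ P) periodic rewrite length-orient x P =
  fromList (x ∷ P) ,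
  period2⇒p2Config _ (twoPeriodic⇒period2 (subst TwoPeriodic (sym (Vec.toList∘fromList (x ∷ P))) periodic)) ,
  cong orient (Vec.toList∘fromList (x ∷ P))

MarksFlat : Dir → Bool → Set
MarksFlat d b = b ≡ true → d ≡ flat

data FirstSegment : List ℤ → List Bool → Set where
  whole : ∀ {D S} → splitAux (orient D) S ≡ (orient D , []) → FirstSegment D S
  cutAt : ∀ {S} a A b B S′ → last a A ≡ b →
          Pointwise MarksFlat (orient (b ∷ B)) S′ → length S′ < length S →
          splitAux (orient ((a ∷ A) ++ b ∷ B)) S ≡ (orient (a ∷ A) , split (orient (b ∷ B)) S′) →
          FirstSegment ((a ∷ A) ++ b ∷ B) S

firstSegment : ∀ D S → Pointwise MarksFlat (orient D) S → FirstSegment D S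
firstSegment []            []          []              = whole refl
firstSegment (x ∷ [])      []          []              = whole refl
firstSegment (x ∷ y ∷ D)   (true ∷ S)  (marked ∷ marks) =
  cutAt x [] y D S (dirOf≡flat⇒≡ x y (marked refl)) marks (ℕ.n<1+n _) refl
firstSegment (x ∷ y ∷ D)   (false ∷ S) (_ ∷ marks) with firstSegment (y ∷ D) S marks
... | whole eq = whole (cong (λ (p , ps) → dirOf x y ∷ p , ps) eq)
... | cutAt a A b B S′ flatJunction marks′ shorter eq =
  cutAt x (a ∷ A) b B S′ flatJunction marks′ (ℕ.m<n⇒m<1+n shorter)
    (cong (λ (p , ps) → dirOf x a ∷ p , ps) eq)

split-≡ : ∀ {R S p ps} → splitAux R S ≡ (p , ps) → split R S ≡ p ∷ ps
split-≡ {R} {S} eq rewrite eq = refl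

split-p2Orientations : ∀ D S → Acc _<_ (length S) → TwoPeriodic D → Pointwise MarksFlat (orient D) S →
  All (λ p → IsP2Orientation (suc (length p)) p) (split (orient D) S)
split-p2Orientations D S (acc shorter⇒acc) periodic marks with firstSegment D S marks
... | whole eq rewrite split-≡ eq = twoPeriodic⇒p2Orientation D periodic ∷ []
... | cutAt a A b B S′ flatJunction marks′ shorter eq rewrite split-≡ eq
  with twoPeriodic-cut a A b B flatJunction periodic
...   | periodicA , periodicB =
  twoPeriodic⇒p2Orientation (a ∷ A) periodicA ∷
  split-p2Orientations (b ∷ B) S′ (shorter⇒acc shorter) periodicB marks′

mainTheorem10 : (n : ℕ) → 2 ≤ n → (R : List Dir) → IsP2Orientation n R →
    (S : List Bool) → Pointwise (λ d b → b ≡ true → d ≡ flat) R S →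
    All (λ p → IsP2Orientation (suc (length p)) p) (split R S)
mainTheorem10 n _ R (D , p2 , refl) S marks =
  split-p2Orientations (toList D) S (<-wellFounded (length S)) (period2⇒twoPeriodic (p2Config⇒period2 _ p2)) marks
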